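{- Let $G$ be a finite group. The power graph $Pow(G)$ is $2$-edge connected (i.e., connected and without bridges) if and only if $G$ has no maximal cyclic subgroup of order $2$.
   Context: For a finite group $G$, the power graph $Pow(G)$ is the simple undirected graph with vertex set $G$ in which two distinct elements $x,y$ are adjacent if and only if one of them is an integer power of the other. A cyclic subgroup $C$ of $G$ is a maximal cyclic subgroup if it is not properly contained in any cyclic subgroup of $G$. -}

module Defs where

open import Level using (0ℓ)
open import Data.Nat using (ℕ; zero; suc)
open import Data.Integer using (ℤ; +_; -[1+_])
open import Data.Fin using (Fin)
open import Data.Product using (Σ; ∃; _×_; _,_)
open import Data.Sum using (_⊎_)
open import Relation.Nullary using (¬_)
open import Relation.Binary.PropositionalEquality using (_≡_; _≢_)
open import Algebra.Structures using (IsGroup)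

-- Finite groups: a group structure on Fin n (every finite group is
-- isomorphic to one of these), with propositional equality.

record FiniteGroup (n : ℕ) : Set where
  field
    _∙_     : Fin n → Fin n → Fin n
    ε       : Fin n
    _⁻¹     : Fin n → Fin n
    isGroup : IsGroup _≡_ _∙_ ε _⁻¹

module _ {n : ℕ} (G : FiniteGroup n) where
  open FiniteGroup G

  powℕ : Fin n → ℕ → Fin n
  powℕ x zero    = ε
  powℕ x (suc k) = x ∙ powℕ x k

  powℤ : Fin n → ℤ → Fin n
  powℤ x (+ k)     = powℕ x k
  powℤ x -[1+ k ]  = (powℕ x (suc k)) ⁻¹

  IsPowerOf : Fin n → Fin n → Set
  IsPowerOf y x = ∃ λ (k : ℤ) → y ≡ powℤ x k

  PowAdj : Fin n → Fin n → Set
  PowAdj x y = x ≢ y × (IsPowerOf y x ⊎ IsPowerOf x y)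

  InCyc : Fin n → Fin n → Set
  InCyc x g = IsPowerOf g x

  MaximalCyclic : Fin n → Set
  MaximalCyclic x = ∀ y → (∀ g → InCyc x g → InCyc y g) → (∀ g → InCyc y g → InCyc x g)

  CycOrder2 : Fin n → Set
  CycOrder2 x = Σ (Fin n) λ a → Σ (Fin n) λ b →
    a ≢ b × (∀ g → (InCyc x g → g ≡ a ⊎ g ≡ b) × (g ≡ a ⊎ g ≡ b → InCyc x g))

-- Simple graphs given by a (symmetric, irreflexive) adjacency relation.

module _ {V : Set} where

  data Walk (E : V → V → Set) : V → V → Set where
    here : ∀ {u} → Walk E u u
    step : ∀ {u v w} → E u v → Walk E v w → Walk E u w

  Connected : (V → V → Set) → Set
  Connected E = ∀ u v → Walk E u v

  DeleteEdge : (V → V → Set) → V → V → (V → V → Set)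
  DeleteEdge E a b u v = E u v × ¬ ((u ≡ a × v ≡ b) ⊎ (u ≡ b × v ≡ a))

  IsBridge : (V → V → Set) → V → V → Set
  IsBridge E a b = E a b × ¬ Walk (DeleteEdge E a b) a b

  TwoEdgeConnected : (V → V → Set) → Set
  TwoEdgeConnected E = Connected E × (∀ a b → ¬ IsBridge E a b)

{-# OPTIONS --safe #-}
-- The identity ε is adjacent to every other vertex of Pow(G), so Pow(G) is
-- connected and every edge {a, b} with a, b ≠ ε lies on the triangle a – ε – b;
-- hence every bridge has the form {x, ε}.  If x⁻¹ ≠ x, then x – x⁻¹ – ε is a
-- detour, and if ⟨x⟩ ⊊ ⟨y⟩, then x – y – ε is one; so a bridge {x, ε} forces
-- ⟨x⟩ = {ε, x} to be maximal cyclic.  Conversely, if ⟨x⟩ = {ε, x} is maximal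
-- cyclic, then every neighbour v of x lies in ⟨x⟩ (either directly or because
-- ⟨x⟩ ⊆ ⟨v⟩ forces equality), so v = ε and {x, ε} is a pendant edge.
module Submission where

open import Defs
open import Level using (0ℓ)
open import Data.Nat using (ℕ; zero; suc)
open import Data.Integer using (+_; -[1+_])
open import Data.Fin using (Fin)
open import Data.Fin.Properties using (_≟_)
open import Data.Product using (∃; _×_; _,_; proj₁; proj₂)
open import Data.Sum using (_⊎_; inj₁; inj₂)
open import Data.Empty using (⊥-elim)
open import Function using (id)
open import Function.Bundles using (_⇔_; mk⇔)
open import Relation.Nullary using (¬_; yes; no)
open import Relation.Binary.PropositionalEquality
open import Algebra.Bundles using (Group)
open import Algebra.Structures using (IsGroup)
import Algebra.Properties.Group as GroupProperties

pair⊆pair : ∀ {A : Set} {a b u v w : A} → u ≢ v →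
            (u ≡ a ⊎ u ≡ b) → (v ≡ a ⊎ v ≡ b) → (w ≡ a ⊎ w ≡ b) → w ≡ u ⊎ w ≡ v
pair⊆pair u≢v (inj₁ refl) (inj₁ refl) _           = ⊥-elim (u≢v refl)
pair⊆pair _   (inj₁ refl) (inj₂ refl) (inj₁ refl) = inj₁ refl
pair⊆pair _   (inj₁ refl) (inj₂ refl) (inj₂ refl) = inj₂ refl
pair⊆pair _   (inj₂ refl) (inj₁ refl) (inj₁ refl) = inj₂ refl
pair⊆pair _   (inj₂ refl) (inj₁ refl) (inj₂ refl) = inj₁ refl
pair⊆pair u≢v (inj₂ refl) (inj₂ refl) _           = ⊥-elim (u≢v refl)

module _ {V : Set} where

  _++ʷ_ : ∀ {E : V → V → Set} {u v w} → Walk E u v → Walk E v w → Walk E u w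
  here     ++ʷ q = q
  step e p ++ʷ q = step e (p ++ʷ q)

  mapʷ : ∀ {E F : V → V → Set} → (∀ {u v} → E u v → F u v) →
         ∀ {u v} → Walk E u v → Walk F u v
  mapʷ f here       = here
  mapʷ f (step e p) = step (f e) (mapʷ f p)

  reverseʷ : ∀ {E : V → V → Set} → (∀ {u v} → E u v → E v u) →
             ∀ {u v} → Walk E u v → Walk E v u
  reverseʷ sym-E here       = here
  reverseʷ sym-E (step e p) = reverseʷ sym-E p ++ʷ step (sym-E e) here

module _ {V : Set} {E : V → V → Set} where

  DeleteEdge-swap : ∀ {a b u v} → DeleteEdge E a b u v → DeleteEdge E b a u v
  DeleteEdge-swap (e , avoid) = e , λ
    { (inj₁ uv≡ba) → avoid (inj₂ uv≡ba)
    ; (inj₂ uv≡ab) → avoid (inj₁ uv≡ab) }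

  DeleteEdge-sym : (∀ {u v} → E u v → E v u) →
                   ∀ {a b u v} → DeleteEdge E a b u v → DeleteEdge E a b v u
  DeleteEdge-sym sym-E (e , avoid) = sym-E e , λ
    { (inj₁ (v≡a , u≡b)) → avoid (inj₂ (u≡b , v≡a))
    ; (inj₂ (v≡b , u≡a)) → avoid (inj₁ (u≡a , v≡b)) }

  IsBridge-sym : (∀ {u v} → E u v → E v u) → ∀ {a b} → IsBridge E a b → IsBridge E b a
  IsBridge-sym sym-E (e , no-walk) =
    sym-E e , λ w → no-walk (mapʷ DeleteEdge-swap (reverseʷ (DeleteEdge-sym sym-E) w))

  detour : ∀ {a b v} → E a v → E v b → v ≢ a → v ≢ b → Walk (DeleteEdge E a b) a b
  detour {a} {b} {v} e-av e-vb v≢a v≢b = step (e-av , avoid-av) (step (e-vb , avoid-vb) here)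
    where
      avoid-av : ¬ ((a ≡ a × v ≡ b) ⊎ (a ≡ b × v ≡ a))
      avoid-av (inj₁ (_ , v≡b))   = v≢b v≡b
      avoid-av (inj₂ (a≡b , v≡a)) = v≢b (trans v≡a a≡b)
      avoid-vb : ¬ ((v ≡ a × b ≡ b) ⊎ (v ≡ b × b ≡ a))
      avoid-vb (inj₁ (v≡a , _))   = v≢a v≡a
      avoid-vb (inj₂ (v≡b , b≡a)) = v≢a (trans v≡b b≡a)

  pendant⇒bridge : ∀ {a b} → E a b → a ≢ b → (∀ {v} → E a v → v ≡ b) → IsBridge E a b
  pendant⇒bridge {a} {b} e a≢b pendant = e , λ w → a≢b (sym (stuck w))
    where
      stuck : ∀ {c} → Walk (DeleteEdge E a b) a c → c ≡ a
      stuck here                    = refl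
      stuck (step (e-av , avoid) _) = ⊥-elim (avoid (inj₁ (refl , pendant e-av)))

module PowerGraph {n : ℕ} (G : FiniteGroup n) where
  open FiniteGroup G
  open IsGroup isGroup using (identityˡ; identityʳ; inverseʳ)

  group : Group 0ℓ 0ℓ
  group = record
    { Carrier = Fin n ; _≈_ = _≡_ ; _∙_ = _∙_ ; ε = ε ; _⁻¹ = _⁻¹ ; isGroup = isGroup }

  open GroupProperties group using (ε⁻¹≈ε; ⁻¹-injective)

  ⁻¹≢ε : ∀ {x} → x ≢ ε → x ⁻¹ ≢ ε
  ⁻¹≢ε x≢ε x⁻¹≡ε = x≢ε (⁻¹-injective (trans x⁻¹≡ε (sym ε⁻¹≈ε)))

  powℕ-ε : ∀ k → powℕ G ε k ≡ ε
  powℕ-ε zero    = refl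
  powℕ-ε (suc k) = trans (cong (ε ∙_) (powℕ-ε k)) (identityˡ ε)

  powℤ-ε : ∀ k → powℤ G ε k ≡ ε
  powℤ-ε (+ k)     = powℕ-ε k
  powℤ-ε -[1+ k ] = trans (cong _⁻¹ (powℕ-ε (suc k))) ε⁻¹≈ε

  involution-powℕ : ∀ {x} → x ⁻¹ ≡ x → ∀ k → powℕ G x k ≡ ε ⊎ powℕ G x k ≡ x
  involution-powℕ x⁻¹≡x zero = inj₁ refl
  involution-powℕ {x} x⁻¹≡x (suc k) with involution-powℕ x⁻¹≡x k
  ... | inj₁ xᵏ≡ε = inj₂ (trans (cong (x ∙_) xᵏ≡ε) (identityʳ x))
  ... | inj₂ xᵏ≡x = inj₁ (trans (cong (x ∙_) (trans xᵏ≡x (sym x⁻¹≡x))) (inverseʳ x))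

  involution-powℤ : ∀ {x} → x ⁻¹ ≡ x → ∀ k → powℤ G x k ≡ ε ⊎ powℤ G x k ≡ x
  involution-powℤ x⁻¹≡x (+ k) = involution-powℕ x⁻¹≡x k
  involution-powℤ x⁻¹≡x -[1+ k ] with involution-powℕ x⁻¹≡x (suc k)
  ... | inj₁ xᵏ≡ε = inj₁ (trans (cong _⁻¹ xᵏ≡ε) ε⁻¹≈ε)
  ... | inj₂ xᵏ≡x = inj₂ (trans (cong _⁻¹ xᵏ≡x) x⁻¹≡x)

  IsPowerOf-refl : ∀ x → IsPowerOf G x x
  IsPowerOf-refl x = + 1 , sym (identityʳ x)

  ε-IsPowerOf : ∀ x → IsPowerOf G ε x
  ε-IsPowerOf x = + 0 , refl

  ⁻¹-IsPowerOf : ∀ x → IsPowerOf G (x ⁻¹) x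
  ⁻¹-IsPowerOf x = -[1+ 0 ] , cong _⁻¹ (sym (identityʳ x))

  IsPowerOf-ε : ∀ {y} → IsPowerOf G y ε → y ≡ ε
  IsPowerOf-ε (k , y≡εᵏ) = trans y≡εᵏ (powℤ-ε k)

  CycOrder2⇒≢ε : ∀ {x} → CycOrder2 G x → x ≢ ε
  CycOrder2⇒≢ε (a , b , a≢b , cyc) refl =
    a≢b (trans (IsPowerOf-ε (proj₂ (cyc a) (inj₁ refl)))
               (sym (IsPowerOf-ε (proj₂ (cyc b) (inj₂ refl)))))

  CycOrder2⇒⟨x⟩⊆⟨ε,x⟩ : ∀ {x g} → CycOrder2 G x → InCyc G x g → g ≡ ε ⊎ g ≡ x
  CycOrder2⇒⟨x⟩⊆⟨ε,x⟩ {x} order2@(a , b , _ , cyc) g∈⟨x⟩ =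
    pair⊆pair (≢-sym (CycOrder2⇒≢ε order2))
      (proj₁ (cyc ε) (ε-IsPowerOf x)) (proj₁ (cyc x) (IsPowerOf-refl x)) (proj₁ (cyc _) g∈⟨x⟩)

  CycOrder2⇒⟨x⟩⊆⟨v⟩ : ∀ {x v} → CycOrder2 G x → InCyc G v x → ∀ g → InCyc G x g → InCyc G v g
  CycOrder2⇒⟨x⟩⊆⟨v⟩ {v = v} order2 x∈⟨v⟩ g g∈⟨x⟩ with CycOrder2⇒⟨x⟩⊆⟨ε,x⟩ order2 g∈⟨x⟩
  ... | inj₁ refl = ε-IsPowerOf v
  ... | inj₂ refl = x∈⟨v⟩

  involution⇒CycOrder2 : ∀ {x} → x ≢ ε → x ⁻¹ ≡ x → CycOrder2 G x
  involution⇒CycOrder2 {x} x≢ε x⁻¹≡x = ε , x , ≢-sym x≢ε , λ g →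
    (λ { (k , refl) → involution-powℤ x⁻¹≡x k }) ,
    (λ { (inj₁ refl) → ε-IsPowerOf x ; (inj₂ refl) → IsPowerOf-refl x })

  PowAdj-sym : ∀ {u v} → PowAdj G u v → PowAdj G v u
  PowAdj-sym (u≢v , inj₁ v∈⟨u⟩) = ≢-sym u≢v , inj₂ v∈⟨u⟩
  PowAdj-sym (u≢v , inj₂ u∈⟨v⟩) = ≢-sym u≢v , inj₁ u∈⟨v⟩

  PowAdj-ε : ∀ {x} → x ≢ ε → PowAdj G x ε
  PowAdj-ε {x} x≢ε = x≢ε , inj₁ (ε-IsPowerOf x)

  walk-to-ε : ∀ u → Walk (PowAdj G) u ε
  walk-to-ε u with u ≟ ε
  ... | yes refl = here
  ... | no u≢ε   = step (PowAdj-ε u≢ε) here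

  PowAdj-connected : Connected (PowAdj G)
  PowAdj-connected u v = walk-to-ε u ++ʷ reverseʷ PowAdj-sym (walk-to-ε v)

  bridge⇒incident-ε : ∀ {a b} → IsBridge (PowAdj G) a b → a ≡ ε ⊎ b ≡ ε
  bridge⇒incident-ε {a} {b} (_ , no-walk) with a ≟ ε | b ≟ ε
  ... | yes a≡ε | _       = inj₁ a≡ε
  ... | no _    | yes b≡ε = inj₂ b≡ε
  ... | no a≢ε  | no b≢ε  =
    ⊥-elim (no-walk (detour (PowAdj-ε a≢ε) (PowAdj-sym (PowAdj-ε b≢ε)) (≢-sym a≢ε) (≢-sym b≢ε)))

  ε-bridge⇒involution : ∀ {x} → IsBridge (PowAdj G) x ε → x ⁻¹ ≡ x
  ε-bridge⇒involution {x} ((x≢ε , _) , no-walk) with x ⁻¹ ≟ x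
  ... | yes x⁻¹≡x = x⁻¹≡x
  ... | no x⁻¹≢x  = ⊥-elim (no-walk (detour (≢-sym x⁻¹≢x , inj₁ (⁻¹-IsPowerOf x))
                                            (PowAdj-ε (⁻¹≢ε x≢ε)) x⁻¹≢x (⁻¹≢ε x≢ε)))

  ε-bridge⇒maximal : ∀ {x} → IsBridge (PowAdj G) x ε → MaximalCyclic G x
  ε-bridge⇒maximal {x} ((x≢ε , _) , no-walk) y ⟨x⟩⊆⟨y⟩ with y ≟ x
  ... | yes refl = λ _ → id
  ... | no y≢x   = ⊥-elim (no-walk (detour (≢-sym y≢x , inj₂ x∈⟨y⟩) (PowAdj-ε y≢ε) y≢x y≢ε))
    where
      x∈⟨y⟩ : InCyc G y x
      x∈⟨y⟩ = ⟨x⟩⊆⟨y⟩ x (IsPowerOf-refl x)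
      y≢ε : y ≢ ε
      y≢ε refl = x≢ε (IsPowerOf-ε x∈⟨y⟩)

  ε-bridge⇒maximal-order2 : ∀ {x} → IsBridge (PowAdj G) x ε →
                            ∃ λ x → MaximalCyclic G x × CycOrder2 G x
  ε-bridge⇒maximal-order2 {x} bridge =
    x , ε-bridge⇒maximal bridge ,
    involution⇒CycOrder2 (proj₁ (proj₁ bridge)) (ε-bridge⇒involution bridge)

  bridge⇒maximal-order2 : ∀ {a b} → IsBridge (PowAdj G) a b →
                          ∃ λ x → MaximalCyclic G x × CycOrder2 G x
  bridge⇒maximal-order2 bridge with bridge⇒incident-ε bridge
  ... | inj₁ refl = ε-bridge⇒maximal-order2 (IsBridge-sym PowAdj-sym bridge)
  ... | inj₂ refl = ε-bridge⇒maximal-order2 bridge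

  maximal-order2⇒bridge : ∀ {x} → MaximalCyclic G x → CycOrder2 G x → IsBridge (PowAdj G) x ε
  maximal-order2⇒bridge {x} maximal order2 = pendant⇒bridge (PowAdj-ε x≢ε) x≢ε neighbour≡ε
    where
      x≢ε : x ≢ ε
      x≢ε = CycOrder2⇒≢ε order2
      v∈⟨x⟩ : ∀ {v} → IsPowerOf G v x ⊎ IsPowerOf G x v → InCyc G x v
      v∈⟨x⟩     (inj₁ v∈⟨x⟩) = v∈⟨x⟩
      v∈⟨x⟩ {v} (inj₂ x∈⟨v⟩) = maximal v (CycOrder2⇒⟨x⟩⊆⟨v⟩ order2 x∈⟨v⟩) v (IsPowerOf-refl v)
      neighbour≡ε : ∀ {v} → PowAdj G x v → v ≡ ε
      neighbour≡ε (x≢v , adj) with CycOrder2⇒⟨x⟩⊆⟨ε,x⟩ order2 (v∈⟨x⟩ adj)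
      ... | inj₁ v≡ε = v≡ε
      ... | inj₂ v≡x = ⊥-elim (x≢v (sym v≡x))

mainTheorem5 : (n : ℕ) (G : FiniteGroup n) →
    TwoEdgeConnected (PowAdj G) ⇔ (¬ ∃ λ x → MaximalCyclic G x × CycOrder2 G x)
mainTheorem5 n G = mk⇔ forward backward
  where
    open PowerGraph G

    forward : TwoEdgeConnected (PowAdj G) → ¬ ∃ λ x → MaximalCyclic G x × CycOrder2 G x
    forward (_ , no-bridge) (x , maximal , order2) = no-bridge x _ (maximal-order2⇒bridge maximal order2)

    backward : ¬ (∃ λ x → MaximalCyclic G x × CycOrder2 G x) → TwoEdgeConnected (PowAdj G)
    backward none = PowAdj-connected , λ a b bridge → none (bridge⇒maximal-order2 bridge)
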